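{- There is no $CW(155,36)$.
   Context: $C_v$ is the cyclic group of order $v$. A $CW(v,n)$ is an element $D=\sum_ga_gg\in\mathbb{Z}[C_v]$ with all $a_g\in\{0,\pm1\}$ and $DD^{(-1)}=n$, where $D^{(-1)}=\sum_ga_gg^{ -1}$; equivalently, a $v\times v$ circulant matrix $M$ with entries in $\{0,\pm1\}$ and $MM^T=nI$. -}

module Defs where

open import Data.Nat using (ℕ; zero; suc; NonZero)
open import Data.Nat.DivMod using (_%_)
open import Data.Fin using (Fin; toℕ; fromℕ<)
open import Data.Fin.Properties using ()
open import Data.Nat.DivMod using (m%n<n)
open import Data.Integer using (ℤ; +_; -[1+_]; _*_; _+_)
open import Data.Product using (Σ; _×_)
open import Data.Sum using (_⊎_)
open import Relation.Binary.PropositionalEquality using (_≡_)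
open import Relation.Nullary using (¬_)

∑ : ∀ {v} → (Fin v → ℤ) → ℤ
∑ {zero}  f = + 0
∑ {suc v} f = f Fin.zero + ∑ (λ i → f (Fin.suc i))
  where import Data.Fin as Fin

-- Group operation of the cyclic group C_v, modelled as Fin v = ℤ/vℤ.
_⊕_ : ∀ {v} .{{_ : NonZero v}} → Fin v → Fin v → Fin v
_⊕_ {v} i j = fromℕ< (m%n<n (toℕ i Data.Nat.+ toℕ j) v)
  where import Data.Nat

⊖_ : ∀ {v} .{{_ : NonZero v}} → Fin v → Fin v
⊖_ {v} i = fromℕ< (m%n<n (v Data.Nat.∸ toℕ i) v)
  where import Data.Nat

Trit : ℤ → Set
Trit a = (a ≡ + 0) ⊎ (a ≡ + 1) ⊎ (a ≡ -[1+ 0 ])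

e : ∀ {v} .{{_ : NonZero v}} → Fin v
e {suc v} = Fin.zero
  where import Data.Fin as Fin

-- Coefficient of h in the group-ring product D · E in ℤ[C_v]:
-- (D E)_h = Σ_g D_g E_{g⁻¹ h}.
mulCoeff : ∀ {v} .{{_ : NonZero v}} → (Fin v → ℤ) → (Fin v → ℤ) → Fin v → ℤ
mulCoeff D E h = ∑ (λ g → D g * E ((⊖ g) ⊕ h))

-- D^{(-1)} = Σ_g a_g g⁻¹, i.e. coefficient at g is a_{g⁻¹}.
conj : ∀ {v} .{{_ : NonZero v}} → (Fin v → ℤ) → (Fin v → ℤ)
conj D g = D (⊖ g)

-- Circulant weighing matrix CW(v,n): D ∈ ℤ[C_v] with coefficients in {0,±1}
-- and D D^{(-1)} = n (the element n·1 of the group ring).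
IsCW : (v : ℕ) .{{_ : NonZero v}} → ℕ → (Fin v → ℤ) → Set
IsCW v n D =
  (∀ g → Trit (D g)) ×
  (∀ h → mulCoeff D (conj D) h ≡ (if' h) )
  where
    open import Data.Fin using (_≟_)
    open import Relation.Nullary using (yes; no)
    if' : Fin v → ℤ
    if' h with h ≟ e
    ... | yes _ = + n
    ... | no _  = + 0

-- Let D be a CW(155,36) and E its image under the projection C 155 → C 31. Then
-- E E⁽⁻¹⁾ = 36, and every coefficient of E is a sum of five coefficients of D, so
-- |E_h| ≤ 5. Modulo 3, cubing is the Frobenius map A³ ≡ A⁽³⁾ on ℤ[C 31], and
-- 3¹⁵ ≡ -1, 3³⁰ ≡ 1 (mod 31). Hence B = A^(3¹⁵) ≡ A⁽⁻¹⁾, and A ≡ A^(3³⁰), which is a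
-- multiple of A B ≡ A A⁽⁻¹⁾; so A A⁽⁻¹⁾ ≡ 0 forces A ≡ 0 (mod 3). Thus E = 3x with
-- x a CW(31,4). The coefficient sum of x squares to 4; after negating and
-- translating, x has a -1 at the identity and three further entries 1, and a
-- search through the 4060 placements of these shows that none has x x⁽⁻¹⁾ = 4.

module Submission where

open import Defs
open import Algebra.Bundles using (AbelianGroup)
open import Algebra.Structures using (IsAbelianGroup)
import Algebra.Properties.AbelianGroup as AbelianGroupProperties
open import Data.Empty using (⊥)
open import Data.Fin using (Fin; zero; suc; toℕ; fromℕ<; _≟_)
open import Data.Fin.Permutation using (Permutation′; _⟨$⟩ʳ_; permutation)
open import Data.Fin.Properties using (suc-injective; toℕ-fromℕ<; toℕ-injective; toℕ<n; all?; any?)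
open import Data.Integer using (ℤ; 0ℤ; +_; -[1+_]; _+_; _*_; -_; _-_; _≤_; ∣_∣; +≤+; -≤-; -≤+)
import Data.Integer.Properties as ℤ
open import Data.Integer.Properties
  using ( +-*-semiring; +-identityˡ; +-identityʳ; +-inverseʳ; +-mono-≤; +-monoʳ-≤; ≤-refl; ≤-antisym
        ; *-comm; *-assoc; *-zeroˡ; *-zeroʳ; *-distribˡ-+; *-distribʳ-+; *-cancelʳ-≡; neg-distrib-+ )
open import Data.Integer.Divisibility.Signed using (_∣_; divides; ∣m∣n⇒∣m+n; ∣m⇒∣-m; ∣m⇒∣m*n; ∣n⇒∣m*n; ∣-refl)
open import Data.Integer.Tactic.RingSolver using (solve-∀)
import Algebra.Properties.Semiring.Sum +-*-semiring as Sum
open import Data.Nat as ℕ using (ℕ; zero; suc; _%_; _∸_; s≤s; z≤n)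
open import Data.Nat.Divisibility using () renaming (_∣_ to _∣ℕ_; divides to dividesℕ)
open import Data.Nat.DivMod using (m%n<n; m<n⇒m%n≡m; %-distribˡ-+; n%n≡0; m∣n⇒o%n%m≡o%m)
open import Data.Nat.GeneralisedArithmetic using (fold; iterate; fold-+)
import Data.Nat.Properties as ℕ
open import Data.Product using (Σ; ∃; _×_; _,_; uncurry)
open import Data.Sum using (_⊎_; inj₁; inj₂; [_,_]′)
open import Function using (_∘_; _⇔_; Equivalence; mk⇔)
open import Function.Construct.Composition using (_⇔-∘_)
open import Relation.Binary.Bundles using (Setoid)
open import Relation.Binary.Structures using (IsEquivalence)
open import Relation.Binary.PropositionalEquality
open import Relation.Binary.PropositionalEquality.Algebra using (isMagma)
import Relation.Binary.Reasoning.Setoid as SetoidReasoning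
open import Relation.Nullary using (¬_; ¬?; Dec; yes; no; contradiction)
open import Relation.Nullary.Decidable using (from-yes; map′; _×-dec_)

private
  variable
    k m n : ℕ

∑≡sum : (f : Fin n → ℤ) → ∑ f ≡ Sum.sum f
∑≡sum {zero}  f = refl
∑≡sum {suc n} f = cong (_+_ (f zero)) (∑≡sum (λ i → f (suc i)))

∑-cong : {f g : Fin n → ℤ} → f ≗ g → ∑ f ≡ ∑ g
∑-cong {zero}  f≗g = refl
∑-cong {suc n} f≗g = cong₂ _+_ (f≗g zero) (∑-cong (λ i → f≗g (suc i)))

∑-distrib-+ : (f g : Fin n → ℤ) → ∑ (λ i → f i + g i) ≡ ∑ f + ∑ g
∑-distrib-+ f g = begin
  ∑ (λ i → f i + g i)       ≡⟨ ∑≡sum (λ i → f i + g i) ⟩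
  Sum.sum (λ i → f i + g i) ≡⟨ Sum.∑-distrib-+ f g ⟩
  Sum.sum f + Sum.sum g     ≡⟨ sym (cong₂ _+_ (∑≡sum f) (∑≡sum g)) ⟩
  ∑ f + ∑ g                 ∎
  where open ≡-Reasoning

∑-comm : (f : Fin m → Fin n → ℤ) → ∑ (λ i → ∑ (λ j → f i j)) ≡ ∑ (λ j → ∑ (λ i → f i j))
∑-comm f = begin
  ∑ (λ i → ∑ (f i))                     ≡⟨ ∑-cong (λ i → ∑≡sum (f i)) ⟩
  ∑ (λ i → Sum.sum (f i))               ≡⟨ ∑≡sum (λ i → Sum.sum (f i)) ⟩
  Sum.sum (λ i → Sum.sum (f i))         ≡⟨ Sum.∑-comm f ⟩
  Sum.sum (λ j → Sum.sum (λ i → f i j)) ≡⟨ sym (∑≡sum (λ j → Sum.sum (λ i → f i j))) ⟩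
  ∑ (λ j → Sum.sum (λ i → f i j))       ≡⟨ sym (∑-cong (λ j → ∑≡sum (λ i → f i j))) ⟩
  ∑ (λ j → ∑ (λ i → f i j))             ∎
  where open ≡-Reasoning

∑-permute : (f : Fin n → ℤ) (σ : Permutation′ n) → ∑ f ≡ ∑ (λ i → f (σ ⟨$⟩ʳ i))
∑-permute f σ = trans (∑≡sum f) (trans (Sum.∑-permute f σ) (sym (∑≡sum (λ i → f (σ ⟨$⟩ʳ i)))))

*-distribˡ-∑ : (c : ℤ) (f : Fin n → ℤ) → c * ∑ f ≡ ∑ (λ i → c * f i)
*-distribˡ-∑ c f = trans (cong (c *_) (∑≡sum f)) (trans (Sum.*-distribˡ-sum c f) (sym (∑≡sum (λ i → c * f i))))

*-distribʳ-∑ : (c : ℤ) (f : Fin n → ℤ) → ∑ f * c ≡ ∑ (λ i → f i * c)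
*-distribʳ-∑ c f = trans (cong (_* c) (∑≡sum f)) (trans (Sum.*-distribʳ-sum c f) (sym (∑≡sum (λ i → f i * c))))

∑-zero : ∑ {n} (λ _ → 0ℤ) ≡ 0ℤ
∑-zero {n} = trans (∑≡sum {n} (λ _ → 0ℤ)) (Sum.sum-replicate-zero n)

neg-distrib-∑ : (f : Fin n → ℤ) → - ∑ f ≡ ∑ (λ i → - f i)
neg-distrib-∑ {zero}  f = refl
neg-distrib-∑ {suc n} f =
  trans (neg-distrib-+ (f zero) _) (cong (_+_ (- f zero)) (neg-distrib-∑ (λ i → f (suc i))))

∑-tail : (f : Fin (suc n) → ℤ) → ∑ (f ∘ suc) ≡ ∑ f - f zero
∑-tail f = peel (f zero) (∑ (f ∘ suc))
  where
  peel : ∀ a b → b ≡ (a + b) - a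
  peel = solve-∀

∑-mono-≤ : {f g : Fin n → ℤ} → (∀ i → f i ≤ g i) → ∑ f ≤ ∑ g
∑-mono-≤ {zero}  f≤g = ≤-refl
∑-mono-≤ {suc n} f≤g = +-mono-≤ (f≤g zero) (∑-mono-≤ (λ i → f≤g (suc i)))

∑-nonneg≡0⇒≡0 : (f : Fin n → ℤ) → (∀ i → 0ℤ ≤ f i) → ∑ f ≡ 0ℤ → ∀ i → f i ≡ 0ℤ
∑-nonneg≡0⇒≡0 {suc n} f f≥0 ∑f≡0 = λ
  { zero    → f₀≡0
  ; (suc i) → ∑-nonneg≡0⇒≡0 (λ i → f (suc i)) (λ i → f≥0 (suc i)) rest≡0 i }
  where
  rest≥0 : 0ℤ ≤ ∑ (λ i → f (suc i))
  rest≥0 = subst (_≤ ∑ (λ i → f (suc i))) (∑-zero {n}) (∑-mono-≤ (λ i → f≥0 (suc i)))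
  f₀≡0 : f zero ≡ 0ℤ
  f₀≡0 = ≤-antisym (subst₂ _≤_ (+-identityʳ (f zero)) ∑f≡0 (+-monoʳ-≤ (f zero) rest≥0)) (f≥0 zero)
  rest≡0 : ∑ (λ i → f (suc i)) ≡ 0ℤ
  rest≡0 = trans (sym (+-identityˡ _)) (trans (cong (_+ ∑ (λ i → f (suc i))) (sym f₀≡0)) ∑f≡0)

iverson : ∀ {p} {P : Set p} → Dec P → ℤ → ℤ
iverson (yes _) x = x
iverson (no _)  _ = 0ℤ

module _ {p q} {P : Set p} {Q : Set q} where

  iverson-cong : P ⇔ Q → (d : Dec P) (d′ : Dec Q) (x : ℤ) → iverson d x ≡ iverson d′ x
  iverson-cong _   (yes _)  (yes _) _ = refl
  iverson-cong _   (no _)   (no _)  _ = refl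
  iverson-cong P⇔Q (yes p)  (no ¬q) _ = contradiction (Equivalence.to P⇔Q p) ¬q
  iverson-cong P⇔Q (no ¬p)  (yes q) _ = contradiction (Equivalence.from P⇔Q q) ¬p

  iverson-comm : (d : Dec P) (d′ : Dec Q) (x : ℤ) → iverson d (iverson d′ x) ≡ iverson d′ (iverson d x)
  iverson-comm (yes _) _ _ = refl
  iverson-comm (no _) (yes _) _ = refl
  iverson-comm (no _) (no _) _ = refl

module _ {p} {P : Set p} where

  iverson-*ˡ : (d : Dec P) (x y : ℤ) → iverson d (x * y) ≡ x * iverson d y
  iverson-*ˡ (yes _) x y = refl
  iverson-*ˡ (no _)  x y = sym (*-zeroʳ x)

  iverson-*ʳ : (d : Dec P) (x y : ℤ) → iverson d x * y ≡ iverson d (x * y)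
  iverson-*ʳ (yes _) x y = refl
  iverson-*ʳ (no _)  x y = *-zeroˡ y

  iverson-∑ : (d : Dec P) (f : Fin n → ℤ) → iverson d (∑ f) ≡ ∑ (λ i → iverson d (f i))
  iverson-∑ (yes _) f = refl
  iverson-∑ {n} (no _)  f = sym (∑-zero {n})

  iverson-mono-≤ : (d : Dec P) {x y : ℤ} → x ≤ y → iverson d x ≤ iverson d y
  iverson-mono-≤ (yes _) x≤y = x≤y
  iverson-mono-≤ (no _)  x≤y = ≤-refl

∑-iverson-≟ : (a : Fin n) (f : Fin n → ℤ) → ∑ (λ i → iverson (i ≟ a) (f i)) ≡ f a
∑-iverson-≟ {suc n} zero    f = trans (cong (_+_ (f zero)) (∑-zero {n})) (+-identityʳ (f zero))
∑-iverson-≟ {suc n} (suc a) f = trans (+-identityˡ _) (begin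
  ∑ (λ i → iverson (suc i ≟ suc a) (f (suc i)))
    ≡⟨ ∑-cong (λ i → iverson-cong (mk⇔ suc-injective (cong suc)) (suc i ≟ suc a) (i ≟ a) (f (suc i))) ⟩
  ∑ (λ i → iverson (i ≟ a) (f (suc i)))
    ≡⟨ ∑-iverson-≟ a (λ i → f (suc i)) ⟩
  f (suc a) ∎)
  where open ≡-Reasoning

∑-iverson-≟ˡ : (a : Fin n) (f : Fin n → ℤ) → ∑ (λ i → iverson (a ≟ i) (f i)) ≡ f a
∑-iverson-≟ˡ a f = trans (∑-cong (λ i → iverson-cong (mk⇔ sym sym) (a ≟ i) (i ≟ a) (f i))) (∑-iverson-≟ a f)

∣-∑ : {k : ℤ} (f : Fin n → ℤ) → (∀ i → k ∣ f i) → k ∣ ∑ f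
∣-∑ {zero} {k} f k∣f = divides 0ℤ (sym (*-zeroˡ k))
∣-∑ {suc n} f k∣f = ∣m∣n⇒∣m+n (k∣f zero) (∣-∑ (λ i → f (suc i)) (λ i → k∣f (suc i)))

Bit : ℤ → Set
Bit a = a ≡ 0ℤ ⊎ a ≡ + 1

trit-≤ : {a : ℤ} → Trit a → a ≤ + 1
trit-≤ (inj₁ refl)        = +≤+ z≤n
trit-≤ (inj₂ (inj₁ refl)) = +≤+ (s≤s z≤n)
trit-≤ (inj₂ (inj₂ refl)) = -≤+

≤-trit : {a : ℤ} → Trit a → -[1+ 0 ] ≤ a
≤-trit (inj₁ refl)        = -≤+
≤-trit (inj₂ (inj₁ refl)) = -≤+
≤-trit (inj₂ (inj₂ refl)) = -≤- z≤n

trit-neg : {a : ℤ} → Trit a → Trit (- a)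
trit-neg (inj₁ refl)        = inj₁ refl
trit-neg (inj₂ (inj₁ refl)) = inj₂ (inj₂ refl)
trit-neg (inj₂ (inj₂ refl)) = inj₂ (inj₁ refl)

trit⇒a≤a² : {a : ℤ} → Trit a → 0ℤ ≤ a * a - a
trit⇒a≤a² (inj₁ refl)        = +≤+ z≤n
trit⇒a≤a² (inj₂ (inj₁ refl)) = +≤+ z≤n
trit⇒a≤a² (inj₂ (inj₂ refl)) = +≤+ z≤n

trit⇒a²≡a⇒bit : {a : ℤ} → Trit a → a * a - a ≡ 0ℤ → Bit a
trit⇒a²≡a⇒bit (inj₁ refl)        _ = inj₁ refl
trit⇒a²≡a⇒bit (inj₂ (inj₁ refl)) _ = inj₂ refl
trit⇒a²≡a⇒bit (inj₂ (inj₂ refl)) ()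

trit≢-1⇒a²≡a : {a : ℤ} → Trit a → a ≢ -[1+ 0 ] → a * a ≡ a
trit≢-1⇒a²≡a (inj₁ refl)        _    = refl
trit≢-1⇒a²≡a (inj₂ (inj₁ refl)) _    = refl
trit≢-1⇒a²≡a (inj₂ (inj₂ refl)) a≢-1 = contradiction refl a≢-1

bit-nonneg : {a : ℤ} → Bit a → 0ℤ ≤ a
bit-nonneg (inj₁ refl) = +≤+ z≤n
bit-nonneg (inj₂ refl) = +≤+ z≤n

×3-bounded⇒trit : (x : ℤ) → -[1+ 4 ] ≤ x * + 3 → x * + 3 ≤ + 5 → Trit x
×3-bounded⇒trit (+ 0)           _ _ = inj₁ refl
×3-bounded⇒trit (+ 1)           _ _ = inj₂ (inj₁ refl)
×3-bounded⇒trit -[1+ 0 ]        _ _ = inj₂ (inj₂ refl)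
×3-bounded⇒trit (+ suc (suc _)) _ (+≤+ (s≤s (s≤s (s≤s (s≤s (s≤s ()))))))
×3-bounded⇒trit -[1+ suc _ ]    (-≤- (s≤s (s≤s (s≤s (s≤s ()))))) _

m*m≡4⇒m≡2 : ∀ m → m ℕ.* m ≡ 4 → m ≡ 2
m*m≡4⇒m≡2 0 ()
m*m≡4⇒m≡2 1 ()
m*m≡4⇒m≡2 2 _ = refl
m*m≡4⇒m≡2 (suc (suc (suc m))) m²≡4 =
  contradiction (subst (9 ℕ.≤_) m²≡4 (ℕ.*-mono-≤ 3≤3+m 3≤3+m)) λ { (s≤s (s≤s (s≤s (s≤s ())))) }
  where
  3≤3+m : 3 ℕ.≤ 3 ℕ.+ m
  3≤3+m = s≤s (s≤s (s≤s z≤n))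

i*i≡4⇒i≡±2 : (i : ℤ) → i * i ≡ + 4 → i ≡ + 2 ⊎ i ≡ -[1+ 1 ]
i*i≡4⇒i≡±2 i i²≡4 = ∣i∣≡2⇒i≡±2 i (m*m≡4⇒m≡2 ∣ i ∣ (trans (sym (ℤ.abs-* i i)) (cong ∣_∣ i²≡4)))
  where
  ∣i∣≡2⇒i≡±2 : (i : ℤ) → ∣ i ∣ ≡ 2 → i ≡ + 2 ⊎ i ≡ -[1+ 1 ]
  ∣i∣≡2⇒i≡±2 (+ _)    refl = inj₁ refl
  ∣i∣≡2⇒i≡±2 -[1+ _ ] refl = inj₂ refl

reduce : ℕ → Fin (suc n)
reduce {n} k = fromℕ< (m%n<n k (suc n))

toℕ-reduce : (k : ℕ) → toℕ (reduce {n} k) ≡ k % suc n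
toℕ-reduce {n} k = toℕ-fromℕ< (m%n<n k (suc n))

reduce-toℕ : (a : Fin (suc n)) → reduce (toℕ a) ≡ a
reduce-toℕ a = toℕ-injective (trans (toℕ-reduce (toℕ a)) (m<n⇒m%n≡m (toℕ<n a)))

reduce-+ : (k l : ℕ) → reduce {n} (k ℕ.+ l) ≡ reduce k ⊕ reduce l
reduce-+ {n} k l = toℕ-injective (begin
  toℕ (reduce {n} (k ℕ.+ l))
    ≡⟨ toℕ-reduce (k ℕ.+ l) ⟩
  (k ℕ.+ l) % suc n
    ≡⟨ %-distribˡ-+ k l (suc n) ⟩
  (k % suc n ℕ.+ l % suc n) % suc n
    ≡⟨ sym (cong₂ (λ a b → (a ℕ.+ b) % suc n) (toℕ-reduce {n} k) (toℕ-reduce {n} l)) ⟩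
  (toℕ (reduce {n} k) ℕ.+ toℕ (reduce {n} l)) % suc n
    ≡⟨ sym (toℕ-reduce (toℕ (reduce {n} k) ℕ.+ toℕ (reduce {n} l))) ⟩
  toℕ (reduce {n} k ⊕ reduce l) ∎)
  where open ≡-Reasoning

reduce-modulus : reduce {n} (suc n) ≡ e
reduce-modulus {n} = toℕ-injective (trans (toℕ-reduce (suc n)) (n%n≡0 (suc n)))

-- By definition a ⊕ b = reduce (toℕ a + toℕ b) and ⊖ a = reduce (n + 1 ∸ toℕ a), so the
-- group laws come from ℕ.
⊕-comm : (a b : Fin (suc n)) → a ⊕ b ≡ b ⊕ a
⊕-comm a b = cong reduce (ℕ.+-comm (toℕ a) (toℕ b))

⊕-assoc : (a b c : Fin (suc n)) → (a ⊕ b) ⊕ c ≡ a ⊕ (b ⊕ c)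
⊕-assoc a b c = begin
  (a ⊕ b) ⊕ c                          ≡⟨ cong ((a ⊕ b) ⊕_) (sym (reduce-toℕ c)) ⟩
  reduce (toℕ a ℕ.+ toℕ b) ⊕ reduce (toℕ c) ≡⟨ sym (reduce-+ (toℕ a ℕ.+ toℕ b) (toℕ c)) ⟩
  reduce (toℕ a ℕ.+ toℕ b ℕ.+ toℕ c)   ≡⟨ cong reduce (ℕ.+-assoc (toℕ a) (toℕ b) (toℕ c)) ⟩
  reduce (toℕ a ℕ.+ (toℕ b ℕ.+ toℕ c)) ≡⟨ reduce-+ (toℕ a) (toℕ b ℕ.+ toℕ c) ⟩
  reduce (toℕ a) ⊕ (b ⊕ c)             ≡⟨ cong (_⊕ (b ⊕ c)) (reduce-toℕ a) ⟩
  a ⊕ (b ⊕ c)                          ∎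
  where open ≡-Reasoning

⊕-identityˡ : (a : Fin (suc n)) → e ⊕ a ≡ a
⊕-identityˡ = reduce-toℕ

⊕-identityʳ : (a : Fin (suc n)) → a ⊕ e ≡ a
⊕-identityʳ a = trans (⊕-comm a e) (⊕-identityˡ a)

⊖-inverseˡ : (a : Fin (suc n)) → (⊖ a) ⊕ a ≡ e
⊖-inverseˡ {n} a = begin
  (⊖ a) ⊕ a                             ≡⟨ cong ((⊖ a) ⊕_) (sym (reduce-toℕ a)) ⟩
  reduce (suc n ∸ toℕ a) ⊕ reduce (toℕ a) ≡⟨ sym (reduce-+ (suc n ∸ toℕ a) (toℕ a)) ⟩
  reduce (suc n ∸ toℕ a ℕ.+ toℕ a)      ≡⟨ cong reduce (ℕ.m∸n+n≡m (ℕ.<⇒≤ (toℕ<n a))) ⟩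
  reduce (suc n)                        ≡⟨ reduce-modulus ⟩
  e                                     ∎
  where open ≡-Reasoning

⊖-inverseʳ : (a : Fin (suc n)) → a ⊕ (⊖ a) ≡ e
⊖-inverseʳ a = trans (⊕-comm a (⊖ a)) (⊖-inverseˡ a)

⊕-isAbelianGroup : IsAbelianGroup _≡_ (_⊕_ {suc n}) e ⊖_
⊕-isAbelianGroup = record
  { isGroup = record
    { isMonoid = record
      { isSemigroup = record { isMagma = isMagma _⊕_ ; assoc = ⊕-assoc }
      ; identity    = ⊕-identityˡ , ⊕-identityʳ
      }
    ; inverse = ⊖-inverseˡ , ⊖-inverseʳ
    ; ⁻¹-cong = cong ⊖_
    }
  ; comm = ⊕-comm
  }

cyclicGroup : ℕ → AbelianGroup _ _
cyclicGroup n = record { isAbelianGroup = ⊕-isAbelianGroup {n} }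

module _ {n : ℕ} where
  open AbelianGroupProperties (cyclicGroup n) public
    using ()
    renaming ( ⁻¹-involutive to ⊖-involutive
             ; ⁻¹-∙-comm to ⊖-distrib-⊕
             ; inverseʳ-unique to ⊖-unique
             ; \\-leftDividesˡ to ⊕-⊖-cancelˡ
             ; \\-leftDividesʳ to ⊖-⊕-cancelˡ
             )

reduce-toℕ-reduce : {k : ℕ} → suc k ∣ℕ suc n → (x : ℕ) → reduce {k} (toℕ (reduce {n} x)) ≡ reduce x
reduce-toℕ-reduce {n} {k} k∣n x = toℕ-injective (begin
  toℕ (reduce {k} (toℕ (reduce {n} x))) ≡⟨ toℕ-reduce (toℕ (reduce {n} x)) ⟩
  toℕ (reduce {n} x) % suc k            ≡⟨ cong (_% suc k) (toℕ-reduce x) ⟩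
  x % suc n % suc k                     ≡⟨ m∣n⇒o%n%m≡o%m (suc k) (suc n) x k∣n ⟩
  x % suc k                             ≡⟨ sym (toℕ-reduce x) ⟩
  toℕ (reduce {k} x)                    ∎)
  where open ≡-Reasoning

-- The group ring ℤ[C n]

ℤ[C_] : ℕ → Set
ℤ[C v ] = Fin v → ℤ

infixl 7 _⋆_
infixl 6 _⊞_

_⋆_ : ℤ[C suc n ] → ℤ[C suc n ] → ℤ[C suc n ]
_⋆_ = mulCoeff

_⊞_ : ℤ[C n ] → ℤ[C n ] → ℤ[C n ]
(A ⊞ B) g = A g + B g

∑-reindex : (σ τ : Fin n → Fin n) → (∀ g → σ (τ g) ≡ g) → (∀ g → τ (σ g) ≡ g) →
            (f : Fin n → ℤ) → ∑ f ≡ ∑ (f ∘ σ)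
∑-reindex σ τ στ τσ f = ∑-permute f (permutation σ τ στ τσ)

∑-translate : (a : Fin (suc n)) (f : Fin (suc n) → ℤ) → ∑ f ≡ ∑ (λ g → f (a ⊕ g))
∑-translate a = ∑-reindex (a ⊕_) ((⊖ a) ⊕_) (⊕-⊖-cancelˡ a) (⊖-⊕-cancelˡ a)

∑-conj : (A : ℤ[C suc n ]) → ∑ (conj A) ≡ ∑ A
∑-conj A = sym (∑-reindex ⊖_ ⊖_ ⊖-involutive ⊖-involutive A)

⊖-reflect-involutive : (h g : Fin (suc n)) → (⊖ ((⊖ g) ⊕ h)) ⊕ h ≡ g
⊖-reflect-involutive h g = begin
  (⊖ ((⊖ g) ⊕ h)) ⊕ h        ≡⟨ cong (_⊕ h) (sym (⊖-distrib-⊕ (⊖ g) h)) ⟩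
  ((⊖ (⊖ g)) ⊕ (⊖ h)) ⊕ h   ≡⟨ ⊕-assoc (⊖ (⊖ g)) (⊖ h) h ⟩
  (⊖ (⊖ g)) ⊕ ((⊖ h) ⊕ h)   ≡⟨ cong₂ _⊕_ (⊖-involutive g) (⊖-inverseˡ h) ⟩
  g ⊕ e                      ≡⟨ ⊕-identityʳ g ⟩
  g                          ∎
  where open ≡-Reasoning

⋆-cong : {A A′ B B′ : ℤ[C suc n ]} → A ≗ A′ → B ≗ B′ → A ⋆ B ≗ A′ ⋆ B′
⋆-cong A≗A′ B≗B′ h = ∑-cong (λ g → cong₂ _*_ (A≗A′ g) (B≗B′ ((⊖ g) ⊕ h)))

⋆-congˡ : {A A′ : ℤ[C suc n ]} (B : ℤ[C suc n ]) → A ≗ A′ → A ⋆ B ≗ A′ ⋆ B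
⋆-congˡ {A = A} {A′} B A≗A′ = ⋆-cong {A = A} {A′} {B} {B} A≗A′ (λ _ → refl)

⋆-congʳ : (A : ℤ[C suc n ]) {B B′ : ℤ[C suc n ]} → B ≗ B′ → A ⋆ B ≗ A ⋆ B′
⋆-congʳ A {B} {B′} = ⋆-cong {A = A} {A} {B} {B′} (λ _ → refl)

⋆-comm : (A B : ℤ[C suc n ]) → A ⋆ B ≗ B ⋆ A
⋆-comm A B h = begin
  ∑ (λ g → A g * B (reflect g))
    ≡⟨ ∑-reindex reflect reflect (⊖-reflect-involutive h) (⊖-reflect-involutive h) (λ g → A g * B (reflect g)) ⟩
  ∑ (λ g → A (reflect g) * B (reflect (reflect g)))
    ≡⟨ ∑-cong (λ g → cong (λ k → A (reflect g) * B k) (⊖-reflect-involutive h g)) ⟩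
  ∑ (λ g → A (reflect g) * B g)
    ≡⟨ ∑-cong (λ g → *-comm (A (reflect g)) (B g)) ⟩
  ∑ (λ g → B g * A (reflect g)) ∎
  where
  open ≡-Reasoning
  reflect : Fin _ → Fin _
  reflect g = (⊖ g) ⊕ h

⋆-assoc : (A B C : ℤ[C suc n ]) → (A ⋆ B) ⋆ C ≗ A ⋆ (B ⋆ C)
⋆-assoc A B C h = begin
  ∑ (λ g → ∑ (λ k → A k * B ((⊖ k) ⊕ g)) * C ((⊖ g) ⊕ h))
    ≡⟨ ∑-cong (λ g → *-distribʳ-∑ (C ((⊖ g) ⊕ h)) (λ k → A k * B ((⊖ k) ⊕ g))) ⟩
  ∑ (λ g → ∑ (λ k → A k * B ((⊖ k) ⊕ g) * C ((⊖ g) ⊕ h)))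
    ≡⟨ ∑-comm (λ g k → A k * B ((⊖ k) ⊕ g) * C ((⊖ g) ⊕ h)) ⟩
  ∑ (λ k → ∑ (λ g → A k * B ((⊖ k) ⊕ g) * C ((⊖ g) ⊕ h)))
    ≡⟨ ∑-cong (λ k → ∑-cong (λ g → *-assoc (A k) (B ((⊖ k) ⊕ g)) (C ((⊖ g) ⊕ h)))) ⟩
  ∑ (λ k → ∑ (λ g → A k * (B ((⊖ k) ⊕ g) * C ((⊖ g) ⊕ h))))
    ≡⟨ ∑-cong (λ k → sym (*-distribˡ-∑ (A k) (λ g → B ((⊖ k) ⊕ g) * C ((⊖ g) ⊕ h)))) ⟩
  ∑ (λ k → A k * ∑ (λ g → B ((⊖ k) ⊕ g) * C ((⊖ g) ⊕ h)))
    ≡⟨ ∑-cong (λ k → cong (A k *_) (inner k)) ⟩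
  ∑ (λ k → A k * (B ⋆ C) ((⊖ k) ⊕ h)) ∎
  where
  open ≡-Reasoning
  shift : ∀ k m → (⊖ (k ⊕ m)) ⊕ h ≡ (⊖ m) ⊕ ((⊖ k) ⊕ h)
  shift k m = trans (cong (_⊕ h) (trans (sym (⊖-distrib-⊕ k m)) (⊕-comm (⊖ k) (⊖ m)))) (⊕-assoc (⊖ m) (⊖ k) h)
  inner : ∀ k → ∑ (λ g → B ((⊖ k) ⊕ g) * C ((⊖ g) ⊕ h)) ≡ (B ⋆ C) ((⊖ k) ⊕ h)
  inner k = trans (∑-translate k (λ g → B ((⊖ k) ⊕ g) * C ((⊖ g) ⊕ h)))
                  (∑-cong (λ m → cong₂ _*_ (cong B (⊖-⊕-cancelˡ k m)) (cong C (shift k m))))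

⋆-distribˡ-⊞ : (A B C : ℤ[C suc n ]) → A ⋆ (B ⊞ C) ≗ A ⋆ B ⊞ A ⋆ C
⋆-distribˡ-⊞ A B C h =
  trans (∑-cong (λ g → *-distribˡ-+ (A g) (B ((⊖ g) ⊕ h)) (C ((⊖ g) ⊕ h))))
        (∑-distrib-+ (λ g → A g * B ((⊖ g) ⊕ h)) (λ g → A g * C ((⊖ g) ⊕ h)))

⋆-distribʳ-⊞ : (A B C : ℤ[C suc n ]) → (A ⊞ B) ⋆ C ≗ A ⋆ C ⊞ B ⋆ C
⋆-distribʳ-⊞ A B C h =
  trans (∑-cong (λ g → *-distribʳ-+ (C ((⊖ g) ⊕ h)) (A g) (B g)))
        (∑-distrib-+ (λ g → A g * C ((⊖ g) ⊕ h)) (λ g → B g * C ((⊖ g) ⊕ h)))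

⋆-zeroˡ : (B : ℤ[C suc n ]) → (λ _ → 0ℤ) ⋆ B ≗ (λ _ → 0ℤ)
⋆-zeroˡ {n} B h = trans (∑-cong (λ g → *-zeroˡ (B ((⊖ g) ⊕ h)))) (∑-zero {suc n})

δ : Fin (suc n) → ℤ → ℤ[C suc n ]
δ a c g = iverson (g ≟ a) c

δ-⋆ : (a : Fin (suc n)) (c : ℤ) (B : ℤ[C suc n ]) → δ a c ⋆ B ≗ (λ h → c * B ((⊖ a) ⊕ h))
δ-⋆ a c B h = trans (∑-cong (λ g → iverson-*ʳ (g ≟ a) c (B ((⊖ g) ⊕ h))))
                    (∑-iverson-≟ a (λ g → c * B ((⊖ g) ⊕ h)))

∑ᴳ : {m : ℕ} → (Fin m → ℤ[C n ]) → ℤ[C n ]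
∑ᴳ F g = ∑ (λ p → F p g)

δ-decomposition : (A : ℤ[C suc n ]) → A ≗ ∑ᴳ (λ p → δ p (A p))
δ-decomposition A g = sym (∑-iverson-≟ˡ g A)

∑-⋆ : (A B : ℤ[C suc n ]) → ∑ (A ⋆ B) ≡ ∑ A * ∑ B
∑-⋆ A B = begin
  ∑ (λ h → ∑ (λ g → A g * B ((⊖ g) ⊕ h))) ≡⟨ ∑-comm (λ h g → A g * B ((⊖ g) ⊕ h)) ⟩
  ∑ (λ g → ∑ (λ h → A g * B ((⊖ g) ⊕ h))) ≡⟨ ∑-cong (λ g → sym (*-distribˡ-∑ (A g) (λ h → B ((⊖ g) ⊕ h)))) ⟩
  ∑ (λ g → A g * ∑ (λ h → B ((⊖ g) ⊕ h))) ≡⟨ ∑-cong (λ g → cong (A g *_) (sym (∑-translate (⊖ g) B))) ⟩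
  ∑ (λ g → A g * ∑ B)                     ≡⟨ sym (*-distribʳ-∑ (∑ B) A) ⟩
  ∑ A * ∑ B                               ∎
  where open ≡-Reasoning

⋆-conj-identity : (A : ℤ[C suc n ]) → (A ⋆ conj A) e ≡ ∑ (λ g → A g * A g)
⋆-conj-identity A = ∑-cong (λ g → cong (λ k → A g * A k) (trans (cong ⊖_ (⊕-identityʳ (⊖ g))) (⊖-involutive g)))

translate : Fin (suc n) → ℤ[C suc n ] → ℤ[C suc n ]
translate p A g = A (p ⊕ g)

translate-⋆-conj : (p : Fin (suc n)) (A : ℤ[C suc n ]) → translate p A ⋆ conj (translate p A) ≗ A ⋆ conj A
translate-⋆-conj p A h = begin
  ∑ (λ g → A (p ⊕ g) * A (p ⊕ (⊖ ((⊖ g) ⊕ h))))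
    ≡⟨ ∑-translate (⊖ p) (λ g → A (p ⊕ g) * A (p ⊕ (⊖ ((⊖ g) ⊕ h)))) ⟩
  ∑ (λ g → A (p ⊕ ((⊖ p) ⊕ g)) * A (p ⊕ (⊖ ((⊖ ((⊖ p) ⊕ g)) ⊕ h))))
    ≡⟨ ∑-cong (λ g → cong₂ _*_ (cong A (⊕-⊖-cancelˡ p g)) (cong A (untranslate g))) ⟩
  ∑ (λ g → A g * A (⊖ ((⊖ g) ⊕ h))) ∎
  where
  open ≡-Reasoning
  untranslate : ∀ g → p ⊕ (⊖ ((⊖ ((⊖ p) ⊕ g)) ⊕ h)) ≡ ⊖ ((⊖ g) ⊕ h)
  untranslate g = begin
    p ⊕ (⊖ ((⊖ ((⊖ p) ⊕ g)) ⊕ h))       ≡⟨ cong (p ⊕_) (sym (⊖-distrib-⊕ (⊖ ((⊖ p) ⊕ g)) h)) ⟩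
    p ⊕ ((⊖ (⊖ ((⊖ p) ⊕ g))) ⊕ (⊖ h))   ≡⟨ cong (λ k → p ⊕ (k ⊕ (⊖ h))) (⊖-involutive ((⊖ p) ⊕ g)) ⟩
    p ⊕ (((⊖ p) ⊕ g) ⊕ (⊖ h))           ≡⟨ sym (⊕-assoc p ((⊖ p) ⊕ g) (⊖ h)) ⟩
    (p ⊕ ((⊖ p) ⊕ g)) ⊕ (⊖ h)           ≡⟨ cong (_⊕ (⊖ h)) (trans (⊕-⊖-cancelˡ p g) (sym (⊖-involutive g))) ⟩
    (⊖ (⊖ g)) ⊕ (⊖ h)                   ≡⟨ ⊖-distrib-⊕ (⊖ g) h ⟩
    ⊖ ((⊖ g) ⊕ h)                       ∎

negate-⋆-conj : (A : ℤ[C suc n ]) → (-_ ∘ A) ⋆ conj (-_ ∘ A) ≗ A ⋆ conj A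
negate-⋆-conj A h = ∑-cong (λ g → neg-*-neg (A g) (A (⊖ ((⊖ g) ⊕ h))))
  where
  neg-*-neg : ∀ a b → - a * - b ≡ a * b
  neg-*-neg = solve-∀

⋆-interchange : (A B C D : ℤ[C suc n ]) → (A ⋆ B) ⋆ (C ⋆ D) ≗ (A ⋆ C) ⋆ (B ⋆ D)
⋆-interchange A B C D h = begin
  ((A ⋆ B) ⋆ (C ⋆ D)) h ≡⟨ ⋆-assoc A B (C ⋆ D) h ⟩
  (A ⋆ (B ⋆ (C ⋆ D))) h ≡⟨ ⋆-congʳ A (λ k → trans (sym (⋆-assoc B C D k)) (⋆-congˡ D (⋆-comm B C) k)) h ⟩
  (A ⋆ ((C ⋆ B) ⋆ D)) h ≡⟨ ⋆-congʳ A (⋆-assoc C B D) h ⟩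
  (A ⋆ (C ⋆ (B ⋆ D))) h ≡⟨ sym (⋆-assoc A C (B ⋆ D) h) ⟩
  ((A ⋆ C) ⋆ (B ⋆ D)) h ∎
  where open ≡-Reasoning

scale-⋆-scale : (A B : ℤ[C suc n ]) (c d : ℤ) → (λ g → A g * c) ⋆ (λ g → B g * d) ≗ (λ h → (A ⋆ B) h * (c * d))
scale-⋆-scale A B c d h =
  trans (∑-cong (λ g → regroup (A g) (B ((⊖ g) ⊕ h)) c d)) (sym (*-distribʳ-∑ (c * d) (λ g → A g * B ((⊖ g) ⊕ h))))
  where
  regroup : ∀ a b c d → a * c * (b * d) ≡ a * b * (c * d)
  regroup = solve-∀

⋆-conj≗δ⇒∑²≡ : (x : ℤ[C suc n ]) {c : ℤ} → x ⋆ conj x ≗ δ e c → ∑ x * ∑ x ≡ c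
⋆-conj≗δ⇒∑²≡ {n} x {c} xx̄≗δ = begin
  ∑ x * ∑ x          ≡⟨ cong (∑ x *_) (sym (∑-conj x)) ⟩
  ∑ x * ∑ (conj x)   ≡⟨ sym (∑-⋆ x (conj x)) ⟩
  ∑ (x ⋆ conj x)     ≡⟨ ∑-cong xx̄≗δ ⟩
  ∑ (δ {n} e c)      ≡⟨ ∑-iverson-≟ {suc n} e (λ _ → c) ⟩
  c                  ∎
  where open ≡-Reasoning

⋆-conj≗δ⇒∑-squares≡ : (x : ℤ[C suc n ]) {c : ℤ} → x ⋆ conj x ≗ δ e c → ∑ (λ g → x g * x g) ≡ c
⋆-conj≗δ⇒∑-squares≡ x xx̄≗δ = trans (sym (⋆-conj-identity x)) (xx̄≗δ e)

⋆-conj-cong : {A B : ℤ[C suc n ]} → A ≗ B → A ⋆ conj A ≗ B ⋆ conj B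
⋆-conj-cong A≗B = ⋆-cong A≗B (λ g → A≗B (⊖ g))

-- Congruence modulo 3

3∣0 : + 3 ∣ 0ℤ
3∣0 = divides 0ℤ refl

3∣n³-n : ∀ k → + 3 ∣ + k * (+ k * + k) - + k
3∣n³-n zero    = 3∣0
3∣n³-n (suc k) = subst (+ 3 ∣_) (expand (+ k)) (∣m∣n⇒∣m+n (3∣n³-n k) (∣n⇒∣m*n (+ k * + k + + k) ∣-refl))
  where
  expand : ∀ x → (x * (x * x) - x) + (x * x + x) * + 3 ≡ (+ 1 + x) * ((+ 1 + x) * (+ 1 + x)) - (+ 1 + x)
  expand = solve-∀

3∣x³-x : ∀ x → + 3 ∣ x * (x * x) - x
3∣x³-x (+ k)      = 3∣n³-n k
3∣x³-x -[1+ k ]   = subst (+ 3 ∣_) (negate (+ suc k)) (∣m⇒∣-m (3∣n³-n (suc k)))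
  where
  negate : ∀ x → - (x * (x * x) - x) ≡ (- x) * ((- x) * (- x)) - (- x)
  negate = solve-∀

infix 4 _≈₃_

-- A record, so that A and B can be inferred from a proof.
record _≈₃_ (A B : ℤ[C n ]) : Set where
  constructor mk≈₃
  field 3∣difference : ∀ h → + 3 ∣ A h - B h
open _≈₃_ public

≗⇒≈₃ : {A B : ℤ[C n ]} → A ≗ B → A ≈₃ B
≗⇒≈₃ {A = A} A≗B = mk≈₃ λ h →
  subst (λ b → + 3 ∣ A h - b) (A≗B h) (subst (+ 3 ∣_) (sym (+-inverseʳ (A h))) 3∣0)

≈₃-refl : {A : ℤ[C n ]} → A ≈₃ A
≈₃-refl = ≗⇒≈₃ (λ _ → refl)

≈₃-sym : {A B : ℤ[C n ]} → A ≈₃ B → B ≈₃ A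
≈₃-sym {A = A} {B} A≈B = mk≈₃ λ h → subst (+ 3 ∣_) (flip (A h) (B h)) (∣m⇒∣-m (3∣difference A≈B h))
  where
  flip : ∀ a b → - (a - b) ≡ b - a
  flip = solve-∀

≈₃-trans : {A B C : ℤ[C n ]} → A ≈₃ B → B ≈₃ C → A ≈₃ C
≈₃-trans {A = A} {B} {C} A≈B B≈C = mk≈₃ λ h →
  subst (+ 3 ∣_) (chain (A h) (B h) (C h)) (∣m∣n⇒∣m+n (3∣difference A≈B h) (3∣difference B≈C h))
  where
  chain : ∀ a b c → (a - b) + (b - c) ≡ a - c
  chain = solve-∀

≈₃-isEquivalence : IsEquivalence (_≈₃_ {n})
≈₃-isEquivalence = record { refl = ≈₃-refl ; sym = ≈₃-sym ; trans = ≈₃-trans }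

≈₃-setoid : ℕ → Setoid _ _
≈₃-setoid n = record { isEquivalence = ≈₃-isEquivalence {n} }

⊞-cong₃ : {A A′ B B′ : ℤ[C n ]} → A ≈₃ A′ → B ≈₃ B′ → A ⊞ B ≈₃ A′ ⊞ B′
⊞-cong₃ {A = A} {A′} {B} {B′} A≈A′ B≈B′ = mk≈₃ λ h →
  subst (+ 3 ∣_) (regroup (A h) (A′ h) (B h) (B′ h)) (∣m∣n⇒∣m+n (3∣difference A≈A′ h) (3∣difference B≈B′ h))
  where
  regroup : ∀ a a′ b b′ → (a - a′) + (b - b′) ≡ (a + b) - (a′ + b′)
  regroup = solve-∀

⋆-congˡ₃ : {A A′ : ℤ[C suc n ]} (B : ℤ[C suc n ]) → A ≈₃ A′ → A ⋆ B ≈₃ A′ ⋆ B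
⋆-congˡ₃ {A = A} {A′} B A≈A′ = mk≈₃ λ h →
  subst (+ 3 ∣_) (difference h) (∣-∑ _ (λ g → ∣m⇒∣m*n (B ((⊖ g) ⊕ h)) (3∣difference A≈A′ g)))
  where
  open ≡-Reasoning
  distrib : ∀ a a′ b → (a - a′) * b ≡ a * b + - (a′ * b)
  distrib = solve-∀
  difference : ∀ h → ∑ (λ g → (A g - A′ g) * B ((⊖ g) ⊕ h)) ≡ (A ⋆ B) h - (A′ ⋆ B) h
  difference h = begin
    ∑ (λ g → (A g - A′ g) * B ((⊖ g) ⊕ h))
      ≡⟨ ∑-cong (λ g → distrib (A g) (A′ g) (B ((⊖ g) ⊕ h))) ⟩
    ∑ (λ g → A g * B ((⊖ g) ⊕ h) + - (A′ g * B ((⊖ g) ⊕ h)))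
      ≡⟨ ∑-distrib-+ (λ g → A g * B ((⊖ g) ⊕ h)) (λ g → - (A′ g * B ((⊖ g) ⊕ h))) ⟩
    (A ⋆ B) h + ∑ (λ g → - (A′ g * B ((⊖ g) ⊕ h)))
      ≡⟨ cong (_+_ ((A ⋆ B) h)) (sym (neg-distrib-∑ (λ g → A′ g * B ((⊖ g) ⊕ h)))) ⟩
    (A ⋆ B) h - (A′ ⋆ B) h ∎

⋆-congʳ₃ : (A : ℤ[C suc n ]) {B B′ : ℤ[C suc n ]} → B ≈₃ B′ → A ⋆ B ≈₃ A ⋆ B′
⋆-congʳ₃ A {B} {B′} B≈B′ = begin
  A ⋆ B   ≈⟨ ≗⇒≈₃ (⋆-comm A B) ⟩
  B ⋆ A   ≈⟨ ⋆-congˡ₃ A B≈B′ ⟩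
  B′ ⋆ A  ≈⟨ ≗⇒≈₃ (⋆-comm B′ A) ⟩
  A ⋆ B′  ∎
  where open SetoidReasoning (≈₃-setoid _)

⋆-cong₃ : {A A′ B B′ : ℤ[C suc n ]} → A ≈₃ A′ → B ≈₃ B′ → A ⋆ B ≈₃ A′ ⋆ B′
⋆-cong₃ {A = A} {A′} {B} {B′} A≈A′ B≈B′ = begin
  A ⋆ B   ≈⟨ ⋆-congˡ₃ B A≈A′ ⟩
  A′ ⋆ B  ≈⟨ ⋆-congʳ₃ A′ B≈B′ ⟩
  A′ ⋆ B′ ∎
  where open SetoidReasoning (≈₃-setoid _)

-- Opaque: unfolding cube at a concrete order makes typechecking blow up.
opaque
  cube : ℤ[C suc n ] → ℤ[C suc n ]
  cube A = A ⋆ (A ⋆ A)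

  cube-unfold : (A : ℤ[C suc n ]) → cube A ≗ A ⋆ (A ⋆ A)
  cube-unfold A h = refl

cube-cong₃ : {A B : ℤ[C suc n ]} → A ≈₃ B → cube A ≈₃ cube B
cube-cong₃ {A = A} {B} A≈B = begin
  cube A        ≈⟨ ≗⇒≈₃ (cube-unfold A) ⟩
  A ⋆ (A ⋆ A)   ≈⟨ ⋆-cong₃ A≈B (⋆-cong₃ A≈B A≈B) ⟩
  B ⋆ (B ⋆ B)   ≈⟨ ≗⇒≈₃ (λ h → sym (cube-unfold B h)) ⟩
  cube B        ∎
  where open SetoidReasoning (≈₃-setoid _)

⋆-expand : (X A B : ℤ[C suc n ]) →
           X ⋆ ((A ⊞ B) ⋆ (A ⊞ B)) ≗ (X ⋆ (A ⋆ A) ⊞ X ⋆ (A ⋆ B)) ⊞ (X ⋆ (B ⋆ A) ⊞ X ⋆ (B ⋆ B))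
⋆-expand X A B h = begin
  (X ⋆ ((A ⊞ B) ⋆ (A ⊞ B))) h
    ≡⟨ ⋆-congʳ X square h ⟩
  (X ⋆ ((A ⋆ A ⊞ A ⋆ B) ⊞ (B ⋆ A ⊞ B ⋆ B))) h
    ≡⟨ ⋆-distribˡ-⊞ X (A ⋆ A ⊞ A ⋆ B) (B ⋆ A ⊞ B ⋆ B) h ⟩
  (X ⋆ (A ⋆ A ⊞ A ⋆ B)) h + (X ⋆ (B ⋆ A ⊞ B ⋆ B)) h
    ≡⟨ cong₂ _+_ (⋆-distribˡ-⊞ X (A ⋆ A) (A ⋆ B) h) (⋆-distribˡ-⊞ X (B ⋆ A) (B ⋆ B) h) ⟩
  ((X ⋆ (A ⋆ A) ⊞ X ⋆ (A ⋆ B)) ⊞ (X ⋆ (B ⋆ A) ⊞ X ⋆ (B ⋆ B))) h ∎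
  where
  open ≡-Reasoning
  square : (A ⊞ B) ⋆ (A ⊞ B) ≗ (A ⋆ A ⊞ A ⋆ B) ⊞ (B ⋆ A ⊞ B ⋆ B)
  square k = trans (⋆-distribʳ-⊞ A B (A ⊞ B) k)
                   (cong₂ _+_ (⋆-distribˡ-⊞ A A B k) (⋆-distribˡ-⊞ B A B k))

binomial-cube : (A B : ℤ[C suc n ]) →
                (A ⊞ B) ⋆ ((A ⊞ B) ⋆ (A ⊞ B))
                  ≗ (A ⋆ (A ⋆ A) ⊞ B ⋆ (B ⋆ B)) ⊞ (λ h → ((A ⋆ (A ⋆ B)) h + (A ⋆ (B ⋆ B)) h) * + 3)
binomial-cube A B h = begin
  ((A ⊞ B) ⋆ ((A ⊞ B) ⋆ (A ⊞ B))) h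
    ≡⟨ ⋆-distribʳ-⊞ A B ((A ⊞ B) ⋆ (A ⊞ B)) h ⟩
  (A ⋆ ((A ⊞ B) ⋆ (A ⊞ B))) h + (B ⋆ ((A ⊞ B) ⋆ (A ⊞ B))) h
    ≡⟨ cong₂ _+_ (⋆-expand A A B h) (⋆-expand B A B h) ⟩
  (AAA + AAB) + (ABA + ABB) + ((BAA + BAB) + (BBA + BBB))
    ≡⟨ cong₂ (λ x y → (AAA + AAB) + (x + ABB) + y) ABA≡AAB
             (cong₂ _+_ (cong₂ _+_ BAA≡AAB BAB≡ABB) (cong (_+ BBB) BBA≡ABB)) ⟩
  (AAA + AAB) + (AAB + ABB) + ((AAB + ABB) + (ABB + BBB))
    ≡⟨ collect AAA AAB ABB BBB ⟩
  (AAA + BBB) + (AAB + ABB) * + 3 ∎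
  where
  open ≡-Reasoning
  AAA = (A ⋆ (A ⋆ A)) h
  AAB = (A ⋆ (A ⋆ B)) h
  ABA = (A ⋆ (B ⋆ A)) h
  ABB = (A ⋆ (B ⋆ B)) h
  BAA = (B ⋆ (A ⋆ A)) h
  BAB = (B ⋆ (A ⋆ B)) h
  BBA = (B ⋆ (B ⋆ A)) h
  BBB = (B ⋆ (B ⋆ B)) h
  ABA≡AAB : ABA ≡ AAB
  ABA≡AAB = ⋆-congʳ A (⋆-comm B A) h
  BAA≡AAB : BAA ≡ AAB
  BAA≡AAB = trans (⋆-comm B (A ⋆ A) h) (⋆-assoc A A B h)
  BAB≡ABB : BAB ≡ ABB
  BAB≡ABB = trans (⋆-comm B (A ⋆ B) h) (⋆-assoc A B B h)
  BBA≡ABB : BBA ≡ ABB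
  BBA≡ABB = trans (⋆-congʳ B (⋆-comm B A) h) BAB≡ABB
  collect : ∀ a x y b → (a + x) + (x + y) + ((x + y) + (y + b)) ≡ (a + b) + (x + y) * + 3
  collect = solve-∀

cube-⊞₃ : (A B : ℤ[C suc n ]) → cube (A ⊞ B) ≈₃ cube A ⊞ cube B
cube-⊞₃ A B = mk≈₃ λ h → divides (AAB h + ABB h) (begin
  cube (A ⊞ B) h - (cube A ⊞ cube B) h
    ≡⟨ cong₂ _-_ (cube-unfold (A ⊞ B) h) (cong₂ _+_ (cube-unfold A h) (cube-unfold B h)) ⟩
  ((A ⊞ B) ⋆ ((A ⊞ B) ⋆ (A ⊞ B))) h - (A ⋆ (A ⋆ A) ⊞ B ⋆ (B ⋆ B)) h
    ≡⟨ cong (_- (A ⋆ (A ⋆ A) ⊞ B ⋆ (B ⋆ B)) h) (binomial-cube A B h) ⟩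
  (A ⋆ (A ⋆ A) ⊞ B ⋆ (B ⋆ B)) h + (AAB h + ABB h) * + 3 - (A ⋆ (A ⋆ A) ⊞ B ⋆ (B ⋆ B)) h
    ≡⟨ cancel ((A ⋆ (A ⋆ A) ⊞ B ⋆ (B ⋆ B)) h) (AAB h + ABB h) ⟩
  (AAB h + ABB h) * + 3 ∎)
  where
  open ≡-Reasoning
  AAB ABB : ℤ[C _ ]
  AAB = A ⋆ (A ⋆ B)
  ABB = A ⋆ (B ⋆ B)
  cancel : ∀ a t → a + t * + 3 - a ≡ t * + 3
  cancel = solve-∀

triple : Fin (suc n) → Fin (suc n)
triple p = p ⊕ (p ⊕ p)

-- 21 · 3 ≡ 1 (mod 31).
third : Fin 31 → Fin 31
third h = reduce (21 ℕ.* toℕ h)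

third-triple : ∀ p → third (triple p) ≡ p
third-triple = from-yes (all? λ p → third (triple p) ≟ p)

triple-third : ∀ h → triple (third h) ≡ h
triple-third = from-yes (all? λ h → triple (third h) ≟ h)

third¹⁵≡⊖ : ∀ h → iterate third h 15 ≡ ⊖ h
third¹⁵≡⊖ = from-yes (all? λ h → iterate third h 15 ≟ ⊖ h)

third³⁰≡id : ∀ h → iterate third h 30 ≡ h
third³⁰≡id = from-yes (all? λ h → iterate third h 30 ≟ h)

⊖-⊖-cancel≡⇔≡triple : (p h : Fin (suc n)) → (⊖ p) ⊕ ((⊖ p) ⊕ h) ≡ p ⇔ h ≡ triple p
⊖-⊖-cancel≡⇔≡triple p h = mk⇔ to from
  where
  to : (⊖ p) ⊕ ((⊖ p) ⊕ h) ≡ p → h ≡ triple p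
  to eq = begin
    h                                 ≡⟨ sym (⊕-⊖-cancelˡ p h) ⟩
    p ⊕ ((⊖ p) ⊕ h)                   ≡⟨ cong (p ⊕_) (sym (⊕-⊖-cancelˡ p ((⊖ p) ⊕ h))) ⟩
    p ⊕ (p ⊕ ((⊖ p) ⊕ ((⊖ p) ⊕ h)))   ≡⟨ cong (λ k → p ⊕ (p ⊕ k)) eq ⟩
    triple p                          ∎
    where open ≡-Reasoning
  from : h ≡ triple p → (⊖ p) ⊕ ((⊖ p) ⊕ h) ≡ p
  from refl = trans (cong ((⊖ p) ⊕_) (⊖-⊕-cancelˡ p (p ⊕ p))) (⊖-⊕-cancelˡ p p)

≡triple⇔third≡ : (h p : Fin 31) → h ≡ triple p ⇔ third h ≡ p
≡triple⇔third≡ h p = mk⇔ (λ eq → trans (cong third eq) (third-triple p))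
                         (λ eq → trans (sym (triple-third h)) (cong triple eq))

infix 10 _⁽³⁾

-- A ⁽³⁾ = ∑ a_g g³, the image of A under the multiplier 3.
_⁽³⁾ : ℤ[C 31 ] → ℤ[C 31 ]
(A ⁽³⁾) h = A (third h)

cube-δ₃ : (p : Fin 31) (c : ℤ) → cube (δ p c) ≈₃ δ p c ⁽³⁾
cube-δ₃ p c = mk≈₃ λ h → subst (+ 3 ∣_) (sym (cong (_- iverson (third h ≟ p) c) (cube-δ h)))
                                        (iverson-cube₃ (third h ≟ p))
  where
  cube-δ : ∀ h → cube (δ p c) h ≡ c * (c * iverson (third h ≟ p) c)
  cube-δ h = begin
    cube (δ p c) h                                       ≡⟨ cube-unfold (δ p c) h ⟩
    (δ p c ⋆ (δ p c ⋆ δ p c)) h                          ≡⟨ δ-⋆ p c (δ p c ⋆ δ p c) h ⟩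
    c * (δ p c ⋆ δ p c) ((⊖ p) ⊕ h)                      ≡⟨ cong (c *_) (δ-⋆ p c (δ p c) ((⊖ p) ⊕ h)) ⟩
    c * (c * iverson ((⊖ p) ⊕ ((⊖ p) ⊕ h) ≟ p) c)        ≡⟨ cong (λ x → c * (c * x)) (iverson-cong
                                                               (≡triple⇔third≡ h p ⇔-∘ ⊖-⊖-cancel≡⇔≡triple p h) _ (third h ≟ p) c) ⟩
    c * (c * iverson (third h ≟ p) c)                    ∎
    where open ≡-Reasoning
  iverson-cube₃ : ∀ {ℓ} {P : Set ℓ} (d : Dec P) → + 3 ∣ c * (c * iverson d c) - iverson d c
  iverson-cube₃ (yes _) = 3∣x³-x c
  iverson-cube₃ (no _)  = divides 0ℤ (vanish c)
    where
    vanish : ∀ c → c * (c * 0ℤ) - 0ℤ ≡ 0ℤ * + 3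
    vanish = solve-∀

frobenius-∑ᴳ : {m : ℕ} (F : Fin m → ℤ[C 31 ]) → (∀ p → cube (F p) ≈₃ F p ⁽³⁾) → cube (∑ᴳ F) ≈₃ ∑ᴳ F ⁽³⁾
frobenius-∑ᴳ {zero}  F _ = ≗⇒≈₃ (λ h → trans (cube-unfold (λ _ → 0ℤ) h) (⋆-zeroˡ ((λ _ → 0ℤ) ⋆ (λ _ → 0ℤ)) h))
frobenius-∑ᴳ {suc m} F frob = begin
  cube (F zero ⊞ ∑ᴳ (λ p → F (suc p)))        ≈⟨ cube-⊞₃ (F zero) (∑ᴳ (λ p → F (suc p))) ⟩
  cube (F zero) ⊞ cube (∑ᴳ (λ p → F (suc p))) ≈⟨ ⊞-cong₃ (frob zero) (frobenius-∑ᴳ (λ p → F (suc p)) (λ p → frob (suc p))) ⟩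
  F zero ⁽³⁾ ⊞ ∑ᴳ (λ p → F (suc p)) ⁽³⁾       ∎
  where open SetoidReasoning (≈₃-setoid 31)

frobenius : (A : ℤ[C 31 ]) → cube A ≈₃ A ⁽³⁾
frobenius A = begin
  cube A                          ≈⟨ cube-cong₃ (≗⇒≈₃ (δ-decomposition A)) ⟩
  cube (∑ᴳ (λ p → δ p (A p)))     ≈⟨ frobenius-∑ᴳ (λ p → δ p (A p)) (λ p → cube-δ₃ p (A p)) ⟩
  ∑ᴳ (λ p → δ p (A p)) ⁽³⁾        ≈⟨ ≗⇒≈₃ (λ h → sym (δ-decomposition A (third h))) ⟩
  A ⁽³⁾                           ∎
  where open SetoidReasoning (≈₃-setoid 31)

infix 4 _∣ᴳ_

record _∣ᴳ_ (A X : ℤ[C suc n ]) : Set where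
  constructor dividesᴳ
  field
    quotient : ℤ[C suc n ]
    equality : X ≗ A ⋆ quotient

∣ᴳ-⋆ʳ : {A X : ℤ[C suc n ]} → A ∣ᴳ X → (Y : ℤ[C suc n ]) → A ∣ᴳ X ⋆ Y
∣ᴳ-⋆ʳ {A = A} (dividesᴳ Z X≗AZ) Y = dividesᴳ (Z ⋆ Y) λ h → trans (⋆-congˡ Y X≗AZ h) (⋆-assoc A Z Y h)

∣ᴳ-⋆ : {A B X Y : ℤ[C suc n ]} → A ∣ᴳ X → B ∣ᴳ Y → A ⋆ B ∣ᴳ X ⋆ Y
∣ᴳ-⋆ {A = A} {B} (dividesᴳ Z X≗AZ) (dividesᴳ W Y≗BW) =
  dividesᴳ (Z ⋆ W) λ h → trans (⋆-cong X≗AZ Y≗BW h) (⋆-interchange A Z B W h)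

∣ᴳ-respʳ-≗ : {A X Y : ℤ[C suc n ]} → X ≗ Y → A ∣ᴳ Y → A ∣ᴳ X
∣ᴳ-respʳ-≗ X≗Y (dividesᴳ Z Y≗AZ) = dividesᴳ Z λ h → trans (X≗Y h) (Y≗AZ h)

∣ᴳ-cube : {A X : ℤ[C suc n ]} → A ∣ᴳ X → A ∣ᴳ cube X
∣ᴳ-cube {X = X} A∣X = ∣ᴳ-respʳ-≗ (cube-unfold X) (∣ᴳ-⋆ʳ A∣X (X ⋆ X))

∣ᴳ-cube-iterate : (A : ℤ[C suc n ]) (k : ℕ) → A ∣ᴳ fold A cube (suc k)
∣ᴳ-cube-iterate A zero    = ∣ᴳ-respʳ-≗ (cube-unfold A) (dividesᴳ (A ⋆ A) λ _ → refl)
∣ᴳ-cube-iterate A (suc k) = ∣ᴳ-cube (∣ᴳ-cube-iterate A k)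

∣ᴳ-≈₃0 : {C Y : ℤ[C suc n ]} → C ≈₃ (λ _ → 0ℤ) → C ∣ᴳ Y → Y ≈₃ (λ _ → 0ℤ)
∣ᴳ-≈₃0 {C = C} {Y} C≈0 (dividesᴳ Z Y≗CZ) = begin
  Y                     ≈⟨ ≗⇒≈₃ Y≗CZ ⟩
  C ⋆ Z                 ≈⟨ ⋆-congˡ₃ Z C≈0 ⟩
  (λ _ → 0ℤ) ⋆ Z        ≈⟨ ≗⇒≈₃ (⋆-zeroˡ Z) ⟩
  (λ _ → 0ℤ)            ∎
  where open SetoidReasoning (≈₃-setoid _)

cube-iterate≈₃⁽³⁾-iterate : (A : ℤ[C 31 ]) (k : ℕ) → fold A cube k ≈₃ fold A _⁽³⁾ k
cube-iterate≈₃⁽³⁾-iterate A zero    = ≈₃-refl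
cube-iterate≈₃⁽³⁾-iterate A (suc k) = begin
  cube (fold A cube k)       ≈⟨ cube-cong₃ (cube-iterate≈₃⁽³⁾-iterate A k) ⟩
  cube (fold A _⁽³⁾ k)       ≈⟨ frobenius (fold A _⁽³⁾ k) ⟩
  fold A _⁽³⁾ k ⁽³⁾          ∎
  where open SetoidReasoning (≈₃-setoid 31)

⁽³⁾-iterate : (A : ℤ[C 31 ]) (k : ℕ) → fold A _⁽³⁾ k ≗ (λ h → A (iterate third h k))
⁽³⁾-iterate A zero    h = refl
⁽³⁾-iterate A (suc k) h = ⁽³⁾-iterate A k (third h)

⋆-conj≈₃0⇒≈₃0 : (A : ℤ[C 31 ]) → A ⋆ conj A ≈₃ (λ _ → 0ℤ) → A ≈₃ (λ _ → 0ℤ)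
⋆-conj≈₃0⇒≈₃0 A AĀ≈0 = begin
  A                   ≈⟨ ≗⇒≈₃ (λ h → trans (cong A (sym (third³⁰≡id h))) (sym (⁽³⁾-iterate A 30 h))) ⟩
  fold A _⁽³⁾ 30      ≈⟨ ≈₃-sym (cube-iterate≈₃⁽³⁾-iterate A 30) ⟩
  cube X              ≈⟨ ∣ᴳ-≈₃0 AB≈0 (∣ᴳ-respʳ-≗ (cube-unfold X) (∣ᴳ-⋆ (∣ᴳ-cube-iterate A 28) (∣ᴳ-⋆ʳ B∣X X))) ⟩
  (λ _ → 0ℤ)          ∎
  where
  open SetoidReasoning (≈₃-setoid 31)
  B X : ℤ[C 31 ]
  B = fold A cube 15
  X = fold A cube 29
  B∣X : B ∣ᴳ X
  B∣X = subst (B ∣ᴳ_) (sym (fold-+ A cube 14 {15})) (∣ᴳ-cube-iterate B 13)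
  B≈Ā : B ≈₃ conj A
  B≈Ā = begin
    B                ≈⟨ cube-iterate≈₃⁽³⁾-iterate A 15 ⟩
    fold A _⁽³⁾ 15   ≈⟨ ≗⇒≈₃ (λ h → trans (⁽³⁾-iterate A 15 h) (cong A (third¹⁵≡⊖ h))) ⟩
    conj A           ∎
  AB≈0 : A ⋆ B ≈₃ (λ _ → 0ℤ)
  AB≈0 = begin
    A ⋆ B            ≈⟨ ⋆-congʳ₃ A B≈Ā ⟩
    A ⋆ conj A       ≈⟨ AĀ≈0 ⟩
    (λ _ → 0ℤ)       ∎

-- Projection ℤ[C (n + 1)] → ℤ[C (k + 1)] for k + 1 ∣ n + 1

module Projection {n k : ℕ} (k∣n : suc k ∣ℕ suc n) where

  π : Fin (suc n) → Fin (suc k)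
  π g = reduce (toℕ g)

  π-⊕ : (a b : Fin (suc n)) → π (a ⊕ b) ≡ π a ⊕ π b
  π-⊕ a b = trans (reduce-toℕ-reduce k∣n (toℕ a ℕ.+ toℕ b)) (reduce-+ (toℕ a) (toℕ b))

  π-⊖ : (a : Fin (suc n)) → π (⊖ a) ≡ ⊖ π a
  π-⊖ a = ⊖-unique (π a) (π (⊖ a)) (trans (sym (π-⊕ a (⊖ a))) (cong π (⊖-inverseʳ a)))

  project : ℤ[C suc n ] → ℤ[C suc k ]
  project A i = ∑ (λ g → iverson (π g ≟ i) (A g))

  ∑-project : (A : ℤ[C suc n ]) (F : Fin (suc k) → ℤ) → ∑ (λ g → A g * F (π g)) ≡ ∑ (λ j → project A j * F j)
  ∑-project A F = begin
    ∑ (λ g → A g * F (π g))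
      ≡⟨ ∑-cong (λ g → sym (∑-iverson-≟ˡ (π g) (λ j → A g * F j))) ⟩
    ∑ (λ g → ∑ (λ j → iverson (π g ≟ j) (A g * F j)))
      ≡⟨ ∑-comm (λ g j → iverson (π g ≟ j) (A g * F j)) ⟩
    ∑ (λ j → ∑ (λ g → iverson (π g ≟ j) (A g * F j)))
      ≡⟨ ∑-cong (λ j → ∑-cong (λ g → sym (iverson-*ʳ (π g ≟ j) (A g) (F j)))) ⟩
    ∑ (λ j → ∑ (λ g → iverson (π g ≟ j) (A g) * F j))
      ≡⟨ ∑-cong (λ j → sym (*-distribʳ-∑ (F j) (λ g → iverson (π g ≟ j) (A g)))) ⟩
    ∑ (λ j → project A j * F j) ∎
    where open ≡-Reasoning

  project-translate : (p : Fin (suc n)) (A : ℤ[C suc n ]) → project (translate p A) ≗ translate (π p) (project A)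
  project-translate p A i = begin
    ∑ (λ g → iverson (π g ≟ i) (A (p ⊕ g)))
      ≡⟨ ∑-translate (⊖ p) (λ g → iverson (π g ≟ i) (A (p ⊕ g))) ⟩
    ∑ (λ g → iverson (π ((⊖ p) ⊕ g) ≟ i) (A (p ⊕ ((⊖ p) ⊕ g))))
      ≡⟨ ∑-cong (λ g → trans (cong (iverson (π ((⊖ p) ⊕ g) ≟ i)) (cong A (⊕-⊖-cancelˡ p g)))
                             (iverson-cong (fibre g) (π ((⊖ p) ⊕ g) ≟ i) (π g ≟ π p ⊕ i) (A g))) ⟩
    ∑ (λ g → iverson (π g ≟ π p ⊕ i) (A g)) ∎
    where
    open ≡-Reasoning
    fibre : ∀ g → π ((⊖ p) ⊕ g) ≡ i ⇔ π g ≡ π p ⊕ i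
    fibre g = mk⇔
      (λ eq → trans (sym (⊕-⊖-cancelˡ (π p) (π g)))
                    (cong (π p ⊕_) (trans (cong (_⊕ π g) (sym (π-⊖ p))) (trans (sym (π-⊕ (⊖ p) g)) eq))))
      (λ eq → trans (π-⊕ (⊖ p) g) (trans (cong₂ _⊕_ (π-⊖ p) eq) (⊖-⊕-cancelˡ (π p) i)))

  project-⋆ : (A B : ℤ[C suc n ]) → project (A ⋆ B) ≗ project A ⋆ project B
  project-⋆ A B i = begin
    ∑ (λ g → iverson (π g ≟ i) (∑ (λ h → A h * B ((⊖ h) ⊕ g))))
      ≡⟨ ∑-cong (λ g → iverson-∑ (π g ≟ i) (λ h → A h * B ((⊖ h) ⊕ g))) ⟩
    ∑ (λ g → ∑ (λ h → iverson (π g ≟ i) (A h * B ((⊖ h) ⊕ g))))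
      ≡⟨ ∑-comm (λ g h → iverson (π g ≟ i) (A h * B ((⊖ h) ⊕ g))) ⟩
    ∑ (λ h → ∑ (λ g → iverson (π g ≟ i) (A h * B ((⊖ h) ⊕ g))))
      ≡⟨ ∑-cong (λ h → ∑-cong (λ g → iverson-*ˡ (π g ≟ i) (A h) (B ((⊖ h) ⊕ g)))) ⟩
    ∑ (λ h → ∑ (λ g → A h * iverson (π g ≟ i) (B ((⊖ h) ⊕ g))))
      ≡⟨ ∑-cong (λ h → sym (*-distribˡ-∑ (A h) (λ g → iverson (π g ≟ i) (B ((⊖ h) ⊕ g))))) ⟩
    ∑ (λ h → A h * project (translate (⊖ h) B) i)
      ≡⟨ ∑-cong (λ h → cong (A h *_) (trans (project-translate (⊖ h) B i) (cong (λ j → project B (j ⊕ i)) (π-⊖ h)))) ⟩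
    ∑ (λ h → A h * project B ((⊖ π h) ⊕ i))
      ≡⟨ ∑-project A (λ j → project B ((⊖ j) ⊕ i)) ⟩
    (project A ⋆ project B) i ∎
    where open ≡-Reasoning

  project-conj : (A : ℤ[C suc n ]) → project (conj A) ≗ conj (project A)
  project-conj A i = begin
    ∑ (λ g → iverson (π g ≟ i) (A (⊖ g)))
      ≡⟨ ∑-reindex ⊖_ ⊖_ ⊖-involutive ⊖-involutive (λ g → iverson (π g ≟ i) (A (⊖ g))) ⟩
    ∑ (λ g → iverson (π (⊖ g) ≟ i) (A (⊖ (⊖ g))))
      ≡⟨ ∑-cong (λ g → trans (cong (iverson (π (⊖ g) ≟ i)) (cong A (⊖-involutive g)))
                             (iverson-cong (fibre g) (π (⊖ g) ≟ i) (π g ≟ ⊖ i) (A g))) ⟩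
    ∑ (λ g → iverson (π g ≟ ⊖ i) (A g)) ∎
    where
    open ≡-Reasoning
    fibre : ∀ g → π (⊖ g) ≡ i ⇔ π g ≡ ⊖ i
    fibre g = mk⇔ (λ eq → trans (sym (⊖-involutive (π g))) (cong ⊖_ (trans (sym (π-⊖ g)) eq)))
                  (λ eq → trans (π-⊖ g) (trans (cong ⊖_ eq) (⊖-involutive i)))

  project-δ-e : (c : ℤ) → project (δ e c) ≗ δ e c
  project-δ-e c i = begin
    ∑ (λ g → iverson (π g ≟ i) (iverson (g ≟ e) c)) ≡⟨ ∑-cong (λ g → iverson-comm (π g ≟ i) (g ≟ e) c) ⟩
    ∑ (λ g → iverson (g ≟ e) (iverson (π g ≟ i) c)) ≡⟨ ∑-iverson-≟ e (λ g → iverson (π g ≟ i) c) ⟩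
    iverson (π e ≟ i) c                             ≡⟨ iverson-cong (mk⇔ sym sym) (π e ≟ i) (i ≟ e) c ⟩
    δ e c i                                         ∎
    where open ≡-Reasoning

-- From a CW(155,36) to a CW(31,4)

IsCWᵟ : ℕ → ℤ[C suc n ] → Set
IsCWᵟ k D = (∀ g → Trit (D g)) × D ⋆ conj D ≗ δ e (+ k)

IsCW⇒IsCWᵟ : {k : ℕ} (D : ℤ[C suc n ]) → IsCW (suc n) k D → IsCWᵟ k D
IsCW⇒IsCWᵟ {k = k} D (trits , DD̄) = trits , DD̄≗δ
  where
  DD̄≗δ : D ⋆ conj D ≗ δ e (+ k)
  DD̄≗δ h with h ≟ e | DD̄ h
  ... | yes _ | eq = eq
  ... | no _  | eq = eq

module _ {n k : ℕ} (k∣n : suc k ∣ℕ suc n) where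
  open Projection k∣n

  project-⋆-conj≗δ : (D : ℤ[C suc n ]) {c : ℤ} → D ⋆ conj D ≗ δ e c → project D ⋆ conj (project D) ≗ δ e c
  project-⋆-conj≗δ D {c} DD̄≗δ h = begin
    (project D ⋆ conj (project D)) h ≡⟨ ⋆-congʳ (project D) (λ j → sym (project-conj D j)) h ⟩
    (project D ⋆ project (conj D)) h ≡⟨ sym (project-⋆ D (conj D) h) ⟩
    project (D ⋆ conj D) h           ≡⟨ ∑-cong (λ g → cong (iverson (π g ≟ h)) (DD̄≗δ g)) ⟩
    project (δ e c) h                ≡⟨ project-δ-e c h ⟩
    δ e c h                          ∎
    where open ≡-Reasoning

  project-trits-≤ : (D : ℤ[C suc n ]) → (∀ g → Trit (D g)) → ∀ i → project D i ≤ ∑ (λ g → iverson (π g ≟ i) (+ 1))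
  project-trits-≤ D trits i = ∑-mono-≤ (λ g → iverson-mono-≤ (π g ≟ i) (trit-≤ (trits g)))

  ≤-project-trits : (D : ℤ[C suc n ]) → (∀ g → Trit (D g)) → ∀ i → ∑ (λ g → iverson (π g ≟ i) -[1+ 0 ]) ≤ project D i
  ≤-project-trits D trits i = ∑-mono-≤ (λ g → iverson-mono-≤ (π g ≟ i) (≤-trit (trits g)))

≈₃0⇒×3 : {E : ℤ[C n ]} → E ≈₃ (λ _ → 0ℤ) → ∃ λ (x : ℤ[C n ]) → ∀ i → E i ≡ x i * + 3
≈₃0⇒×3 {E = E} E≈0 = (λ i → _∣_.quotient (3∣difference E≈0 i)) ,
                      (λ i → trans (sym (+-identityʳ (E i))) (_∣_.equality (3∣difference E≈0 i)))

δ-×3≈₃0 : (c : ℤ) → δ {n} e (c * + 3) ≈₃ (λ _ → 0ℤ)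
δ-×3≈₃0 c = mk≈₃ λ h → divides (δ e c h) (trans (+-identityʳ (δ e (c * + 3) h)) (sym (iverson-*ʳ (h ≟ e) c (+ 3))))

÷3-⋆-conj≗δ : (E x : ℤ[C suc n ]) (c : ℤ) → (∀ i → E i ≡ x i * + 3) →
              E ⋆ conj E ≗ δ e (c * + 9) → x ⋆ conj x ≗ δ e c
÷3-⋆-conj≗δ E x c E≗x×3 EĒ≗δ h = *-cancelʳ-≡ ((x ⋆ conj x) h) (δ e c h) (+ 9) (begin
  (x ⋆ conj x) h * + 9                              ≡⟨ sym (scale-⋆-scale x (conj x) (+ 3) (+ 3) h) ⟩
  ((λ g → x g * + 3) ⋆ (λ g → conj x g * + 3)) h    ≡⟨ sym (⋆-cong E≗x×3 (λ g → E≗x×3 (⊖ g)) h) ⟩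
  (E ⋆ conj E) h                                    ≡⟨ EĒ≗δ h ⟩
  δ e (c * + 9) h                                   ≡⟨ sym (iverson-*ʳ (h ≟ e) c (+ 9)) ⟩
  δ e c h * + 9                                     ∎)
  where open ≡-Reasoning

155→31 : 31 ∣ℕ 155
155→31 = dividesℕ 5 refl

open Projection 155→31 using (π)

fibre-size : ∀ i → ∑ (λ g → iverson (π g ≟ i) (+ 1)) ≡ + 5
fibre-size = from-yes (all? λ i → ∑ (λ g → iverson (π g ≟ i) (+ 1)) ℤ.≟ + 5)

fibre-size⁻ : ∀ i → ∑ (λ g → iverson (π g ≟ i) -[1+ 0 ]) ≡ -[1+ 4 ]
fibre-size⁻ = from-yes (all? λ i → ∑ (λ g → iverson (π g ≟ i) -[1+ 0 ]) ℤ.≟ -[1+ 4 ])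

CW155,36⇒CW31,4 : (D : ℤ[C 155 ]) → IsCWᵟ 36 D → ∃ (IsCWᵟ {30} 4)
CW155,36⇒CW31,4 D (trits , DD̄≗δ36) =
  divide-by-3 (≈₃0⇒×3 (⋆-conj≈₃0⇒≈₃0 E (≈₃-trans (≗⇒≈₃ EĒ≗δ36) (δ-×3≈₃0 (+ 12)))))
  where
  open Projection 155→31 using (project)
  E : ℤ[C 31 ]
  E = project D
  EĒ≗δ36 : E ⋆ conj E ≗ δ e (+ 36)
  EĒ≗δ36 = project-⋆-conj≗δ 155→31 D DD̄≗δ36
  -- Matching on the pair keeps x abstract: projecting it out would let the
  -- typechecker unfold the whole divisibility proof.
  divide-by-3 : (∃ λ (x : ℤ[C 31 ]) → ∀ i → E i ≡ x i * + 3) → ∃ (IsCWᵟ 4)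
  divide-by-3 (x , E≗x×3) = x , x-trits , ÷3-⋆-conj≗δ E x (+ 4) E≗x×3 EĒ≗δ36
    where
    x-trits : ∀ i → Trit (x i)
    x-trits i = ×3-bounded⇒trit (x i)
      (subst₂ _≤_ (fibre-size⁻ i) (E≗x×3 i) (≤-project-trits 155→31 D trits i))
      (subst₂ _≤_ (E≗x×3 i) (fibre-size i) (project-trits-≤ 155→31 D trits i))

-- There is no CW(31,4)

data Combination : ℕ → ℕ → Set where
  []   : Combination 0 0
  skip : Combination k n → Combination k (suc n)
  take : Combination k n → Combination (suc k) (suc n)

indicator : Combination k n → Fin n → ℤ
indicator (skip s) zero    = 0ℤ
indicator (take s) zero    = + 1
indicator (skip s) (suc i) = indicator s i
indicator (take s) (suc i) = indicator s i

all-combinations? : {P : Combination k n → Set} → (∀ s → Dec (P s)) → Dec (∀ s → P s)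
all-combinations? {zero}  {zero}  P? = map′ (λ { p [] → p }) (λ ∀P → ∀P []) (P? [])
all-combinations? {suc k} {zero}  P? = yes λ ()
all-combinations? {zero}  {suc n} P? =
  map′ (λ { ∀P (skip s) → ∀P s }) (λ ∀P s → ∀P (skip s)) (all-combinations? (P? ∘ skip))
all-combinations? {suc k} {suc n} P? =
  map′ (λ { (∀P , _) (skip s) → ∀P s ; (_ , ∀P) (take s) → ∀P s })
       (λ ∀P → (λ s → ∀P (skip s)) , (λ s → ∀P (take s)))
       (all-combinations? (P? ∘ skip) ×-dec all-combinations? (P? ∘ take))

bits-indicator : (k : ℕ) (w : Fin n → ℤ) → (∀ i → Bit (w i)) → ∑ w ≡ + k → Σ (Combination k n) λ s → w ≗ indicator s
bits-indicator {zero}  zero    w _ _  = [] , λ ()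
bits-indicator {zero}  (suc k) w _ ()
bits-indicator {suc n} k       w bits ∑w≡k with bits zero | k
... | inj₁ w₀≡0 | k′ =
  let (s , w≗s) = bits-indicator k′ (w ∘ suc) (bits ∘ suc) (trans (∑-tail w) (trans (cong₂ _-_ ∑w≡k w₀≡0) (ℤ.+-identityʳ (+ k′)))) in
  skip s , λ { zero → w₀≡0 ; (suc i) → w≗s i }
... | inj₂ w₀≡1 | zero = contradiction (subst (0ℤ ≤_) (trans (∑-tail w) (cong₂ _-_ ∑w≡k w₀≡1)) ∑tail≥0) λ ()
  where
  ∑tail≥0 : 0ℤ ≤ ∑ (w ∘ suc)
  ∑tail≥0 = subst (_≤ ∑ (w ∘ suc)) (∑-zero {n}) (∑-mono-≤ (bit-nonneg ∘ bits ∘ suc))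
... | inj₂ w₀≡1 | suc k′ =
  let (s , w≗s) = bits-indicator k′ (w ∘ suc) (bits ∘ suc) (trans (∑-tail w) (cong₂ _-_ ∑w≡k w₀≡1)) in
  take s , λ { zero → w₀≡1 ; (suc i) → w≗s i }

candidate : Combination 3 30 → ℤ[C 31 ]
candidate s zero    = -[1+ 0 ]
candidate s (suc i) = indicator s i

no-candidate : ∀ s → ¬ (candidate s ⋆ conj (candidate s) ≗ δ e (+ 4))
no-candidate = from-yes (all-combinations? λ s → ¬? (all? λ h → (candidate s ⋆ conj (candidate s)) h ℤ.≟ δ e (+ 4) h))

no-CW31,4-at-−1 : (y : ℤ[C 31 ]) → IsCWᵟ 4 y → ∑ y ≡ + 2 → y zero ≡ -[1+ 0 ] → ⊥
no-CW31,4-at-−1 y (trits , yȳ≗δ4) ∑y≡2 y₀≡-1 = refute (bits-indicator 3 z z-bits ∑z≡3)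
  where
  z : Fin 30 → ℤ
  z i = y (suc i)
  ∑z≡3 : ∑ z ≡ + 3
  ∑z≡3 = trans (∑-tail y) (cong₂ _-_ ∑y≡2 y₀≡-1)
  ∑z²≡3 : ∑ (λ i → z i * z i) ≡ + 3
  ∑z²≡3 = trans (∑-tail (λ g → y g * y g)) (cong₂ _-_ (⋆-conj≗δ⇒∑-squares≡ y yȳ≗δ4) (cong (λ a → a * a) y₀≡-1))
  ∑[z²-z]≡0 : ∑ (λ i → z i * z i - z i) ≡ 0ℤ
  ∑[z²-z]≡0 = begin
    ∑ (λ i → z i * z i - z i)             ≡⟨ ∑-distrib-+ (λ i → z i * z i) (λ i → - z i) ⟩
    ∑ (λ i → z i * z i) + ∑ (λ i → - z i) ≡⟨ cong₂ _+_ ∑z²≡3 (trans (sym (neg-distrib-∑ z)) (cong -_ ∑z≡3)) ⟩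
    0ℤ                                    ∎
    where open ≡-Reasoning
  z-bits : ∀ i → Bit (z i)
  z-bits i = trit⇒a²≡a⇒bit (trits (suc i))
               (∑-nonneg≡0⇒≡0 (λ i → z i * z i - z i) (λ i → trit⇒a≤a² (trits (suc i))) ∑[z²-z]≡0 i)
  refute : Σ (Combination 3 30) (λ s → z ≗ indicator s) → ⊥
  refute (s , z≗s) = no-candidate s (λ h → trans (sym (⋆-conj-cong y≗candidate h)) (yȳ≗δ4 h))
    where
    y≗candidate : y ≗ candidate s
    y≗candidate zero    = y₀≡-1
    y≗candidate (suc i) = z≗s i

no-CW31,4-∑≡2 : (x : ℤ[C 31 ]) → IsCWᵟ 4 x → ∑ x ≡ + 2 → ⊥
no-CW31,4-∑≡2 x (trits , xx̄≗δ4) ∑x≡2 = by-cases (any? (λ p → x p ℤ.≟ -[1+ 0 ]))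
  where
  by-cases : Dec (∃ λ p → x p ≡ -[1+ 0 ]) → ⊥
  by-cases (yes (p , xₚ≡-1)) =
    no-CW31,4-at-−1 (translate p x) (trits ∘ (p ⊕_) , λ h → trans (translate-⋆-conj p x h) (xx̄≗δ4 h))
                    (trans (sym (∑-translate p x)) ∑x≡2) (trans (cong x (⊕-identityʳ p)) xₚ≡-1)
  by-cases (no ∄-1) = contradiction (trans (sym (⋆-conj≗δ⇒∑-squares≡ x xx̄≗δ4)) (trans ∑x²≡∑x ∑x≡2)) λ ()
    where
    ∑x²≡∑x : ∑ (λ g → x g * x g) ≡ ∑ x
    ∑x²≡∑x = ∑-cong (λ g → trit≢-1⇒a²≡a (trits g) (λ xg≡-1 → ∄-1 (g , xg≡-1)))

no-CW31,4 : (x : ℤ[C 31 ]) → ¬ IsCWᵟ 4 x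
no-CW31,4 x x-cw@(trits , xx̄≗δ4) =
  [ no-CW31,4-∑≡2 x x-cw , ∑x≢-2 ]′ (i*i≡4⇒i≡±2 (∑ x) (⋆-conj≗δ⇒∑²≡ x xx̄≗δ4))
  where
  ∑x≢-2 : ∑ x ≢ -[1+ 1 ]
  ∑x≢-2 ∑x≡-2 = no-CW31,4-∑≡2 (-_ ∘ x) (trit-neg ∘ trits , λ h → trans (negate-⋆-conj x h) (xx̄≗δ4 h))
                              (trans (sym (neg-distrib-∑ x)) (cong -_ ∑x≡-2))

mainTheorem19 : ¬ (∃ λ (D : Fin 155 → ℤ) → IsCW 155 36 D)
mainTheorem19 (D , cw) = uncurry no-CW31,4 (CW155,36⇒CW31,4 D (IsCW⇒IsCWᵟ D cw))
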